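{- Let $m$ and $n$ be integers greater than $2$. Then $F(C_m \square C_n) \geq \left\lceil \frac{mn}{2} \right\rceil$.
   Context: All graphs are simple, finite and undirected; $C_k$ is the cycle on $k$ vertices. The Cartesian product $G \square H$ has vertex set $V(G)\times V(H)$, with $(u,v)$ adjacent to $(u',v')$ iff either $u=u'$ and $vv'\in E(H)$, or $v=v'$ and $uu'\in E(G)$. Zero forcing: each vertex is blue or white; starting from an initial set $S$ of blue vertices, repeatedly apply the color-change rule: if a blue vertex $u$ has exactly one white neighbor $v$, color $v$ blue. $S$ is a zero forcing set if eventually all vertices are blue, and a failed zero forcing set otherwise. $F(G)$ denotes the maximum cardinality of a failed zero forcing set of $G$. -}

module Defs where

open import Data.Nat using (ℕ; zero; suc; _*_; _%_; NonZero)
open import Data.Fin using (Fin; toℕ; remQuot)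
open import Data.Fin.Subset using (Subset; _∈_)
open import Data.Product using (_×_; proj₁; proj₂)
open import Data.Sum using (_⊎_)
open import Relation.Binary.PropositionalEquality using (_≡_)
open import Data.Empty using (⊥)
open import Relation.Nullary using (¬_)

record Graph (n : ℕ) : Set₁ where
  field
    Adj : Fin n → Fin n → Set

open Graph public

-- The cycle C_k on vertices 0,…,k-1: i ~ j iff j ≡ i+1 (mod k) or i ≡ j+1 (mod k).
-- (Simple for k ≥ 3.)
-- Defined by matching on k = suc k' so that the modulus is visibly nonzero
-- (Fin 0 is empty, so nothing is lost).
Cycle : (k : ℕ) → Graph k
Adj (Cycle zero) i j = ⊥
Adj (Cycle (suc k)) i j = (toℕ j ≡ suc (toℕ i) % suc k) ⊎ (toℕ i ≡ suc (toℕ j) % suc k)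

-- Cartesian product G □ H; vertex (u , v) of V(G) × V(H) is encoded as
-- the element of Fin (m * n) whose remQuot is (u , v).
_□_ : {m n : ℕ} → Graph m → Graph n → Graph (m * n)
Adj (_□_ {m} {n} G H) x y =
  (proj₁ (remQuot {m} n x) ≡ proj₁ (remQuot {m} n y) × Adj H (proj₂ (remQuot {m} n x)) (proj₂ (remQuot {m} n y)))
  ⊎ (proj₂ (remQuot {m} n x) ≡ proj₂ (remQuot {m} n y) × Adj G (proj₁ (remQuot {m} n x)) (proj₁ (remQuot {m} n y)))

-- Blue S v : vertex v eventually becomes blue when starting from the blue set S
-- and repeatedly applying the colour-change rule (the final colouring is
-- independent of the order of forces).
data Blue {n : ℕ} (G : Graph n) (S : Subset n) : Fin n → Set where
  initial : ∀ {v} → v ∈ S → Blue G S v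
  force   : ∀ {u v} → Blue G S u → Adj G u v →
            (∀ w → Adj G u w → ¬ (w ≡ v) → Blue G S w) → Blue G S v

ZeroForcingSet : {n : ℕ} → Graph n → Subset n → Set
ZeroForcingSet G S = ∀ v → Blue G S v

FailedZeroForcingSet : {n : ℕ} → Graph n → Subset n → Set
FailedZeroForcingSet G S = ¬ ZeroForcingSet G S

-- A vertex set S fails to force as soon as its complement F is a fort: no vertex outside F
-- has exactly one neighbour in F, so no blue vertex can ever force a vertex of F.
-- In C_k (k ≥ 3) every odd vertex has two distinct even neighbours, so the even vertices
-- form a fort of size ⌈k/2⌉; and a product of forts is a fort of the Cartesian product.
-- Hence the complement of Evens(C_m) × Evens(C_n) is a failed zero forcing set of size
-- mn − ⌈m/2⌉⌈n/2⌉, which is at least ⌈mn/2⌉ because 2⌈m/2⌉⌈n/2⌉ ≤ mn for m, n ≥ 2.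
module Submission where

open import Defs
open import Data.Nat using (ℕ; _*_; _≤_; _<_; ⌈_/2⌉)
open import Data.Fin.Subset using (Subset; ∣_∣)
open import Data.Product using (Σ; _×_)

open import Data.Bool using (Bool; true; false; _∧_; if_then_else_)
open import Data.Empty using (⊥-elim)
open import Data.Fin using (Fin; zero; suc; toℕ; fromℕ<; remQuot; combine)
open import Data.Fin.Properties using (toℕ-fromℕ<; toℕ<n; remQuot-combine; combine-remQuot)
open import Data.Fin.Subset using (_∈_; _∉_; ∁; ⊥; inside; outside)
open import Data.Fin.Subset.Properties using (x∈∁p⇒x∉p; ∣⊥∣≡0; ∣∁p∣≡n∸∣p∣)
open import Data.Nat using (zero; suc; _+_; _∸_; _%_; ⌊_/2⌋; s≤s; NonZero)
open import Data.Nat.DivMod using (n%n≡0; m<n⇒m%n≡m; m%n<n)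
open import Data.Nat.Properties
open import Data.Product using (_,_; proj₁; proj₂; ∃-syntax)
open import Data.Sum using (_⊎_; inj₁; inj₂; swap)
open import Function using (_∘_)
open import Data.Vec using ([]; _∷_; _++_; concat; map; tabulate; lookup)
open import Data.Vec.Properties using ([]=⇒lookup; lookup⇒[]=; lookup-concat; lookup-map; lookup-replicate; lookup∘tabulate)
open import Relation.Binary.PropositionalEquality
open import Data.Nat.Solver using (module +-*-Solver)
open +-*-Solver using (solve; _:+_; _:*_; _:=_; con)

private
  variable
    k m n : ℕ

Fort : Graph n → Subset n → Set
Fort G F = ∀ {u v} → u ∉ F → v ∈ F → Adj G u v → ∃[ w ] Adj G u w × w ≢ v × w ∈ F

module _ {G : Graph n} {F : Subset n} (fort : Fort G F) where

  blue⇒∉fort : ∀ {v} → Blue G (∁ F) v → v ∉ F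
  blue⇒∉fort (initial v∈∁F) = x∈∁p⇒x∉p v∈∁F
  blue⇒∉fort (force bu u~v others) v∈F with fort (blue⇒∉fort bu) v∈F u~v
  ... | w , u~w , w≢v , w∈F = blue⇒∉fort (others w u~w w≢v) w∈F

  fort⇒failed : ∀ {v} → v ∈ F → FailedZeroForcingSet G (∁ F)
  fort⇒failed v∈F zfs = blue⇒∉fort (zfs _) v∈F

∈⇒lookup : ∀ {i} {p : Subset n} → i ∈ p → lookup p i ≡ true
∈⇒lookup = []=⇒lookup

lookup⇒∈ : ∀ {i} {p : Subset n} → lookup p i ≡ true → i ∈ p
lookup⇒∈ = lookup⇒[]= _ _

∣p++q∣≡∣p∣+∣q∣ : (p : Subset m) (q : Subset n) → ∣ p ++ q ∣ ≡ ∣ p ∣ + ∣ q ∣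
∣p++q∣≡∣p∣+∣q∣ []            q = refl
∣p++q∣≡∣p∣+∣q∣ (inside  ∷ p) q = cong suc (∣p++q∣≡∣p∣+∣q∣ p q)
∣p++q∣≡∣p∣+∣q∣ (outside ∷ p) q = ∣p++q∣≡∣p∣+∣q∣ p q

-- Laid out row by row, matching the encoding of the vertices of G □ H by combine/remQuot.
infixr 7 _⊠_
_⊠_ : Subset m → Subset n → Subset (m * n)
p ⊠ q = concat (map (λ x → if x then q else ⊥) p)

∣p⊠q∣≡∣p∣*∣q∣ : (p : Subset m) (q : Subset n) → ∣ p ⊠ q ∣ ≡ ∣ p ∣ * ∣ q ∣
∣p⊠q∣≡∣p∣*∣q∣ []            q = refl
∣p⊠q∣≡∣p∣*∣q∣ (inside  ∷ p) q = trans (∣p++q∣≡∣p∣+∣q∣ q (p ⊠ q)) (cong (∣ q ∣ +_) (∣p⊠q∣≡∣p∣*∣q∣ p q))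
∣p⊠q∣≡∣p∣*∣q∣ {n = n} (outside ∷ p) q = begin
  ∣ ⊥ {n} ++ p ⊠ q ∣    ≡⟨ ∣p++q∣≡∣p∣+∣q∣ (⊥ {n}) (p ⊠ q) ⟩
  ∣ ⊥ {n} ∣ + ∣ p ⊠ q ∣ ≡⟨ cong₂ _+_ (∣⊥∣≡0 n) (∣p⊠q∣≡∣p∣*∣q∣ p q) ⟩
  ∣ p ∣ * ∣ q ∣         ∎
  where open ≡-Reasoning

lookup-⊠ : (p : Subset m) (q : Subset n) (a : Fin m) (b : Fin n) →
           lookup (p ⊠ q) (combine a b) ≡ lookup p a ∧ lookup q b
lookup-⊠ {n = n} p q a b = begin
  lookup (p ⊠ q) (combine a b)    ≡⟨ lookup-concat (map row p) a b ⟩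
  lookup (lookup (map row p) a) b ≡⟨ cong (λ r → lookup r b) (lookup-map a row p) ⟩
  lookup (row (lookup p a)) b     ≡⟨ lookup-row (lookup p a) ⟩
  lookup p a ∧ lookup q b         ∎
  where
  open ≡-Reasoning
  row : Bool → Subset n
  row x = if x then q else ⊥
  lookup-row : ∀ x → lookup (row x) b ≡ x ∧ lookup q b
  lookup-row true  = refl
  lookup-row false = lookup-replicate b outside

module _ {m n : ℕ} {p : Subset m} {q : Subset n} where

  private
    π₁ : Fin (m * n) → Fin m
    π₁ v = proj₁ (remQuot {m} n v)

    π₂ : Fin (m * n) → Fin n
    π₂ v = proj₂ (remQuot {m} n v)

    ∧≡true⁻ : ∀ {x y} → x ∧ y ≡ true → x ≡ true × y ≡ true
    ∧≡true⁻ {true} y≡true = refl , y≡true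

  combine∈⊠ : ∀ {a b} → a ∈ p → b ∈ q → combine a b ∈ p ⊠ q
  combine∈⊠ {a} {b} a∈p b∈q =
    lookup⇒∈ (trans (lookup-⊠ p q a b) (cong₂ _∧_ (∈⇒lookup a∈p) (∈⇒lookup b∈q)))

  ∈⊠⁺ : ∀ {v} → π₁ v ∈ p → π₂ v ∈ q → v ∈ p ⊠ q
  ∈⊠⁺ {v} a∈p b∈q = subst (_∈ p ⊠ q) (combine-remQuot {m} n v) (combine∈⊠ a∈p b∈q)

  ∈⊠⁻ : ∀ {v} → v ∈ p ⊠ q → π₁ v ∈ p × π₂ v ∈ q
  ∈⊠⁻ {v} v∈p⊠q with ∧≡true⁻ lookup≡true
    where
    lookup≡true : lookup p (π₁ v) ∧ lookup q (π₂ v) ≡ true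
    lookup≡true = trans (sym (lookup-⊠ p q (π₁ v) (π₂ v)))
                        (∈⇒lookup (subst (_∈ p ⊠ q) (sym (combine-remQuot {m} n v)) v∈p⊠q))
  ... | a∈p , b∈q = lookup⇒∈ a∈p , lookup⇒∈ b∈q

  module _ {G : Graph m} {H : Graph n} where

    private
      step-in-row : ∀ {u z} → Adj H (π₂ u) z → Adj (G □ H) u (combine (π₁ u) z)
      step-in-row {u} {z} b~z = inj₁ (sym (cong proj₁ rc) , subst (Adj H (π₂ u)) (sym (cong proj₂ rc)) b~z)
        where rc = remQuot-combine {m} {n} (π₁ u) z

      step-in-column : ∀ {u z} → Adj G (π₁ u) z → Adj (G □ H) u (combine z (π₂ u))
      step-in-column {u} {z} a~z = inj₂ (sym (cong proj₂ rc) , subst (Adj G (π₁ u)) (sym (cong proj₁ rc)) a~z)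
        where rc = remQuot-combine {m} {n} z (π₂ u)

      combine≢ʳ : ∀ {a : Fin m} {z v} → z ≢ π₂ v → combine a z ≢ v
      combine≢ʳ {a} {z} z≢ a,z≡v = z≢ (trans (sym (cong proj₂ (remQuot-combine {m} {n} a z))) (cong π₂ a,z≡v))

      combine≢ˡ : ∀ {z} {b : Fin n} {v} → z ≢ π₁ v → combine z b ≢ v
      combine≢ˡ {z} {b} z≢ z,b≡v = z≢ (trans (sym (cong proj₁ (remQuot-combine {m} {n} z b))) (cong π₁ z,b≡v))

    ⊠-fort : Fort G p → Fort H q → Fort (G □ H) (p ⊠ q)
    ⊠-fort fortG fortH {u} {v} u∉ v∈ (inj₁ (same-row , b~b′)) with ∈⊠⁻ v∈
    ... | a′∈p , b′∈q with fortH b∉q b′∈q b~b′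
      where
      b∉q : π₂ u ∉ q
      b∉q b∈q = u∉ (∈⊠⁺ (subst (_∈ p) (sym same-row) a′∈p) b∈q)
    ... | z , b~z , z≢b′ , z∈q =
      combine (π₁ u) z , step-in-row b~z , combine≢ʳ z≢b′ ,
      combine∈⊠ (subst (_∈ p) (sym same-row) a′∈p) z∈q
    ⊠-fort fortG fortH {u} {v} u∉ v∈ (inj₂ (same-column , a~a′)) with ∈⊠⁻ v∈
    ... | a′∈p , b′∈q with fortG a∉p a′∈p a~a′
      where
      a∉p : π₁ u ∉ p
      a∉p a∈p = u∉ (∈⊠⁺ a∈p (subst (_∈ q) (sym same-column) b′∈q))
    ... | z , a~z , z≢a′ , z∈p =
      combine z (π₂ u) , step-in-column a~z , combine≢ˡ z≢a′ ,
      combine∈⊠ z∈p (subst (_∈ q) (sym same-column) b′∈q)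

even odd : ℕ → Bool
even zero    = true
even (suc n) = odd n
odd  zero    = false
odd  (suc n) = even n

even-or-odd : ∀ n → even n ≡ true ⊎ odd n ≡ true
even-or-odd zero    = inj₁ refl
even-or-odd (suc n) = swap (even-or-odd n)

evens odds : (k : ℕ) → Subset k
evens k = tabulate (even ∘ toℕ)
odds  k = tabulate (odd ∘ toℕ)

∈evens⁺ : ∀ {i : Fin k} → even (toℕ i) ≡ true → i ∈ evens k
∈evens⁺ {i = i} even-i = lookup⇒∈ (trans (lookup∘tabulate (even ∘ toℕ) i) even-i)

∣evens∣≡⌈k/2⌉ : ∀ k → ∣ evens k ∣ ≡ ⌈ k /2⌉
∣odds∣≡⌊k/2⌋  : ∀ k → ∣ odds k ∣ ≡ ⌊ k /2⌋
∣evens∣≡⌈k/2⌉ zero    = refl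
∣evens∣≡⌈k/2⌉ (suc k) = cong suc (∣odds∣≡⌊k/2⌋ k)
∣odds∣≡⌊k/2⌋  zero    = refl
∣odds∣≡⌊k/2⌋  (suc k) = ∣evens∣≡⌈k/2⌉ k

-- Adj (Cycle (suc k)) i j unfolds to Adj-mod (suc k) (toℕ i) (toℕ j).
Adj-mod : (K : ℕ) .{{_ : NonZero K}} → ℕ → ℕ → Set
Adj-mod K x y = y ≡ suc x % K ⊎ x ≡ suc y % K

module _ {k : ℕ} (2≤k : 2 ≤ k) where

  private
    K : ℕ
    K = suc k

    suc%-cases : ∀ x → x < K → (suc x < K × suc x % K ≡ suc x) ⊎ (suc x ≡ K × suc x % K ≡ 0)
    suc%-cases x x<K with m≤n⇒m<n∨m≡n x<K
    ... | inj₁ 1+x<K = inj₁ (1+x<K , m<n⇒m%n≡m 1+x<K)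
    ... | inj₂ 1+x≡K = inj₂ (1+x≡K , trans (cong (_% K) 1+x≡K) (n%n≡0 K))

    even-next : ∀ x → suc x < K → even x ≡ true → even (suc (suc x) % K) ≡ true
    even-next x 1+x<K even-x with suc%-cases (suc x) 1+x<K
    ... | inj₁ (_ , eq) = trans (cong even eq) even-x
    ... | inj₂ (_ , eq) = cong even eq

    prev≢next : ∀ x → suc x < K → x ≢ suc (suc x) % K
    prev≢next x 1+x<K x≡next with suc%-cases (suc x) 1+x<K
    ... | inj₁ (_ , eq) = <⇒≢ (m<n⇒m<1+n (n<1+n x)) (trans x≡next eq)
    ... | inj₂ (2+x≡K , eq) with trans x≡next eq
    ...   | refl = <⇒≱ 2≤k (≤-reflexive (sym (suc-injective 2+x≡K)))

    prev-unique : ∀ x y → y < K → suc x ≡ suc y % K → y ≡ x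
    prev-unique x y y<K 1+x≡next-y with suc%-cases y y<K
    ... | inj₁ (_ , eq) = suc-injective (sym (trans 1+x≡next-y eq))
    ... | inj₂ (_ , eq) with trans 1+x≡next-y eq
    ...   | ()

  -- An odd vertex x + 1 has the two distinct even neighbours x and x + 2 (mod K).
  odd-vertex-fort : ∀ x y → x < K → y < K → odd x ≡ true → Adj-mod K x y →
                    ∃[ z ] z < K × Adj-mod K x z × z ≢ y × even z ≡ true
  odd-vertex-fort (suc x) y 1+x<K y<K even-x (inj₁ y≡next) =
    x , <⇒≤ 1+x<K , inj₂ (sym (m<n⇒m%n≡m 1+x<K)) ,
    (λ x≡y → prev≢next x 1+x<K (trans x≡y y≡next)) , even-x
  odd-vertex-fort (suc x) y 1+x<K y<K even-x (inj₂ 1+x≡next-y) with prev-unique x y y<K 1+x≡next-y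
  ... | refl =
    suc (suc x) % K , m%n<n (suc (suc x)) K , inj₁ refl ,
    (λ next≡x → prev≢next x 1+x<K (sym next≡x)) , even-next x 1+x<K even-x

  evens-fort : Fort (Cycle (suc k)) (evens (suc k))
  evens-fort {u} {v} u∉evens _ u~v with even-or-odd (toℕ u)
  ... | inj₁ even-u = ⊥-elim (u∉evens (∈evens⁺ even-u))
  ... | inj₂ odd-u with odd-vertex-fort (toℕ u) (toℕ v) (toℕ<n u) (toℕ<n v) odd-u u~v
  ... | z , z<K , u~z , z≢v , even-z =
    w , subst (Adj-mod K (toℕ u)) (sym w≡z) u~z , (λ w≡v → z≢v (trans (sym w≡z) (cong toℕ w≡v))) ,
    ∈evens⁺ (trans (cong even w≡z) even-z)
    where
    w : Fin K
    w = fromℕ< z<K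
    w≡z : toℕ w ≡ z
    w≡z = toℕ-fromℕ< z<K

data Halving : ℕ → Set where
  twice   : ∀ h → Halving (h + h)
  twice+1 : ∀ h → Halving (suc (h + h))

halving : ∀ n → Halving n
halving zero = twice 0
halving (suc n) with halving n
... | twice h   = twice+1 h
... | twice+1 h = subst Halving (cong suc (+-suc h h)) (twice (suc h))

⌈m/2⌉*⌈n/2⌉+⌈m/2⌉*⌈n/2⌉≤m*n : ∀ {m n} → 2 ≤ m → 2 ≤ n →
                              ⌈ m /2⌉ * ⌈ n /2⌉ + ⌈ m /2⌉ * ⌈ n /2⌉ ≤ m * n
⌈m/2⌉*⌈n/2⌉+⌈m/2⌉*⌈n/2⌉≤m*n {m} {n} 2≤m 2≤n with halving m | halving n
... | twice h | _ rewrite sym (n≡⌈n+n/2⌉ h) = begin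
  h * ⌈ n /2⌉ + h * ⌈ n /2⌉ ≡⟨ *-distribʳ-+ ⌈ n /2⌉ h h ⟨
  (h + h) * ⌈ n /2⌉         ≤⟨ *-monoʳ-≤ (h + h) (⌈n/2⌉≤n n) ⟩
  (h + h) * n               ∎
  where open ≤-Reasoning
... | twice+1 h | twice l rewrite sym (n≡⌈n+n/2⌉ l) = begin
  a * l + a * l ≡⟨ *-distribˡ-+ a l l ⟨
  a * (l + l)   ≤⟨ *-monoˡ-≤ (l + l) (⌈n/2⌉≤n (suc (h + h))) ⟩
  suc (h + h) * (l + l) ∎
  where
  open ≤-Reasoning
  a = ⌈ suc (h + h) /2⌉
... | twice+1 zero    | twice+1 _       = ⊥-elim (1+n≰n 2≤m)
... | twice+1 (suc h) | twice+1 zero    = ⊥-elim (1+n≰n 2≤n)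
... | twice+1 (suc h) | twice+1 (suc l)
  rewrite sym (n≡⌊n+n/2⌋ (suc h)) | sym (n≡⌊n+n/2⌋ (suc l)) =
  ≤-trans (m≤m+n _ _) (≤-reflexive (odd-identity h l))
  where
  odd-identity : ∀ h l → (2 + h) * (2 + l) + (2 + h) * (2 + l) + (1 + 2 * h + 2 * l + 2 * h * l)
                         ≡ suc (suc h + suc h) * suc (suc l + suc l)
  odd-identity = solve 2 (λ h l → (con 2 :+ h) :* (con 2 :+ l) :+ (con 2 :+ h) :* (con 2 :+ l)
                                    :+ (con 1 :+ con 2 :* h :+ con 2 :* l :+ con 2 :* h :* l)
                                  := (con 1 :+ (con 1 :+ h) :+ (con 1 :+ h)) :* (con 1 :+ (con 1 :+ l) :+ (con 1 :+ l))) refl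

⌈m*n/2⌉≤m*n∸⌈m/2⌉*⌈n/2⌉ : ∀ {m n} → 2 ≤ m → 2 ≤ n → ⌈ m * n /2⌉ ≤ m * n ∸ ⌈ m /2⌉ * ⌈ n /2⌉
⌈m*n/2⌉≤m*n∸⌈m/2⌉*⌈n/2⌉ {m} {n} 2≤m 2≤n = begin
  ⌈ m * n /2⌉                             ≡⟨ m+n∸m≡n ⌊ m * n /2⌋ ⌈ m * n /2⌉ ⟨
  ⌊ m * n /2⌋ + ⌈ m * n /2⌉ ∸ ⌊ m * n /2⌋ ≡⟨ cong (_∸ ⌊ m * n /2⌋) (⌊n/2⌋+⌈n/2⌉≡n (m * n)) ⟩
  m * n ∸ ⌊ m * n /2⌋                     ≤⟨ ∸-monoʳ-≤ (m * n) c≤⌊m*n/2⌋ ⟩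
  m * n ∸ c                               ∎
  where
  open ≤-Reasoning
  c = ⌈ m /2⌉ * ⌈ n /2⌉
  c≤⌊m*n/2⌋ : c ≤ ⌊ m * n /2⌋
  c≤⌊m*n/2⌋ = ≤-trans (≤-reflexive (n≡⌊n+n/2⌋ c)) (⌊n/2⌋-mono (⌈m/2⌉*⌈n/2⌉+⌈m/2⌉*⌈n/2⌉≤m*n 2≤m 2≤n))

theorem3p5 : (m n : ℕ) → 2 < m → 2 < n →
    Σ (Subset (m * n)) λ S →
      FailedZeroForcingSet (Cycle m □ Cycle n) S × ⌈ m * n /2⌉ ≤ ∣ S ∣
theorem3p5 (suc m) (suc n) (s≤s 2≤m) (s≤s 2≤n) = ∁ F , failed , size
  where
  M = suc m
  N = suc n
  F = evens M ⊠ evens N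
  failed : FailedZeroForcingSet (Cycle M □ Cycle N) (∁ F)
  failed = fort⇒failed (⊠-fort (evens-fort 2≤m) (evens-fort 2≤n))
                       (combine∈⊠ {p = evens M} {q = evens N} {zero} {zero} (∈evens⁺ refl) (∈evens⁺ refl))
  size : ⌈ M * N /2⌉ ≤ ∣ ∁ F ∣
  size = begin
    ⌈ M * N /2⌉                       ≤⟨ ⌈m*n/2⌉≤m*n∸⌈m/2⌉*⌈n/2⌉ (m≤n⇒m≤1+n 2≤m) (m≤n⇒m≤1+n 2≤n) ⟩
    M * N ∸ ⌈ M /2⌉ * ⌈ N /2⌉         ≡⟨ cong (M * N ∸_) (cong₂ _*_ (∣evens∣≡⌈k/2⌉ M) (∣evens∣≡⌈k/2⌉ N)) ⟨
    M * N ∸ ∣ evens M ∣ * ∣ evens N ∣ ≡⟨ cong (M * N ∸_) (∣p⊠q∣≡∣p∣*∣q∣ (evens M) (evens N)) ⟨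
    M * N ∸ ∣ F ∣                     ≡⟨ ∣∁p∣≡n∸∣p∣ F ⟨
    ∣ ∁ F ∣                           ∎
    where open ≤-Reasoning
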